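{- For any nonnegative integer $k$ and positive integer $\ell$, there exists a positive integer $N$ such that the following holds. Let $m$ be a positive integer. If $G$ is a graph that has a vertex-cover of size at most $k$, then every $m$-coloring of $G^\ell$ has weak diameter in $G^\ell$ at most $N$.
   Context: All graphs are finite. A vertex-cover of $G$ is a set $S\subseteq V(G)$ such that $G-S$ has no edge. $G^\ell$ is obtained from $G$ by adding an edge between every two distinct vertices at distance at most $\ell$ in $G$. An $m$-coloring of $H$ is a function $V(H)\to[m]$; it has weak diameter in $H$ at most $d$ if any two vertices in a common monochromatic component (component of the subgraph of $H$ induced by a color class) are at distance at most $d$ in $H$. -}

module Defs where

open import Data.Nat using (ℕ; zero; suc; _≤_)
open import Data.Fin using (Fin)
open import Data.Fin.Subset using (Subset; _∈_; ∣_∣)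
open import Data.Product using (Σ; _×_; ∃)
open import Data.Sum using (_⊎_)
open import Data.Unit using (⊤)
open import Relation.Binary.PropositionalEquality using (_≡_; _≢_)
open import Relation.Nullary using (¬_)
open import Level using (0ℓ)

record SimpleGraph (n : ℕ) : Set₁ where
  field
    Adj    : Fin n → Fin n → Set
    sym    : ∀ {u v} → Adj u v → Adj v u
    irrefl : ∀ {u} → ¬ Adj u u
open SimpleGraph public

data Walk {n : ℕ} (R : Fin n → Fin n → Set) (P : Fin n → Set)
     : ℕ → Fin n → Fin n → Set where
  here : ∀ {u} → P u → Walk R P zero u u
  step : ∀ {len u w v} → P u → R u w → Walk R P len w v → Walk R P (suc len) u v

DistLe : {n : ℕ} → (Fin n → Fin n → Set) → ℕ → Fin n → Fin n → Set
DistLe R d u v = Σ ℕ λ len → len ≤ d × Walk R (λ _ → ⊤) len u v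

Power : {n : ℕ} → SimpleGraph n → ℕ → Fin n → Fin n → Set
Power G ℓ u v = u ≢ v × DistLe (Adj G) ℓ u v

IsVertexCover : {n : ℕ} → SimpleGraph n → Subset n → Set
IsVertexCover G S = ∀ u v → Adj G u v → (u ∈ S) ⊎ (v ∈ S)

SameMonoComponent : {n m : ℕ} → (Fin n → Fin n → Set) → (Fin n → Fin m)
                    → Fin n → Fin n → Set
SameMonoComponent R c u v = Σ ℕ λ len → Walk R (λ w → c w ≡ c u) len u v

WeakDiameterAtMost : {n m : ℕ} → (Fin n → Fin n → Set) → (Fin n → Fin m) → ℕ → Set
WeakDiameterAtMost R c d = ∀ u v → SameMonoComponent R c u v → DistLe R d u v

module Submission where

-- Since every
-- edge of G is an edge of G^ℓ (ℓ ≥ 1), the same bound holds in G^ℓ, so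
-- N = 2k+1 works for every m.
--
-- The distance bound is proved by shortcutting walks: every edge of G meets
-- S, and if a walk starts at x ∈ S we jump to the last visit of x, after
-- which the walk avoids x, so it uses one cover vertex fewer.  Induction on
-- the number of cover vertices the walk may still use gives length ≤ 2b+1.

open import Defs
open import Data.Nat using (ℕ; _≤_; zero; suc; _+_; z≤n; s≤s)
open import Data.Nat.Properties using (≤-trans; ≤-pred; n≤1+n; +-suc; n≮0)
open import Data.Fin using (Fin; _≟_)
open import Data.Fin.Subset using (Subset; ∣_∣; _∈_; _-_)
open import Data.Fin.Subset.Properties using (x∈p⇒∣p-x∣<∣p∣; x∈p∧x≢y⇒x∈p-y)
open import Data.Product using (Σ; _×_; _,_; proj₂)
open import Data.Sum using (_⊎_; inj₁; inj₂)
open import Data.Unit using (⊤; tt)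
open import Data.Empty using (⊥-elim)
open import Relation.Nullary using (yes; no)
open import Relation.Binary.PropositionalEquality using (_≡_; _≢_; refl; subst) renaming (sym to ≡-sym)

Reachable : {n : ℕ} → (Fin n → Fin n → Set) → Fin n → Fin n → Set
Reachable R u v = Σ ℕ λ len → Walk R (λ _ → ⊤) len u v

module WalkFacts {n : ℕ} {R : Fin n → Fin n → Set} where

  weaken : ∀ {P Q : Fin n → Set} {len u v} →
           (∀ {z} → P z → Q z) → Walk R P len u v → Walk R Q len u v
  weaken f (here p)     = here (f p)
  weaken f (step p r w) = step (f p) r (weaken f w)

  start : ∀ {P : Fin n → Set} {len u v} → Walk R P len u v → P u
  start (here p)     = p
  start (step p _ _) = p

  _++ᵂ_ : ∀ {P : Fin n → Set} {l₁ l₂ u w v} →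
          Walk R P l₁ u w → Walk R P l₂ w v → Walk R P (l₁ + l₂) u v
  here _       ++ᵂ W₂ = W₂
  step p r W₁  ++ᵂ W₂ = step p r (W₁ ++ᵂ W₂)

  AfterLastVisit : (P : Fin n → Set) → Fin n → Fin n → Set
  AfterLastVisit P x v =
    (v ≡ x) ⊎ Σ (Fin n) λ w → Σ ℕ λ l → R x w × Walk R (λ z → P z × z ≢ x) l w v

  lastVisit : ∀ {P : Fin n → Set} (x : Fin n) {len u v} → Walk R P len u v →
              Walk R (λ z → P z × z ≢ x) len u v ⊎ AfterLastVisit P x v
  lastVisit x {u = u} (here p) with u ≟ x
  ... | yes u≡x = inj₂ (inj₁ u≡x)
  ... | no  u≢x = inj₁ (here (p , u≢x))
  lastVisit x {u = u} (step {w = w} p r W) with lastVisit x W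
  ... | inj₂ suffix = inj₂ suffix
  ... | inj₁ W-avoids with u ≟ x
  ...   | yes refl = inj₂ (inj₂ (w , _ , r , W-avoids))
  ...   | no  u≢x  = inj₁ (step (p , u≢x) r W-avoids)

open WalkFacts

removeMember : ∀ {n b x} {T : Subset n} → x ∈ T → ∣ T ∣ ≤ suc b → ∣ T - x ∣ ≤ b
removeMember x∈T size = ≤-pred (≤-trans (x∈p⇒∣p-x∣<∣p∣ x∈T) size)

memberNonEmpty : ∀ {n x} {T : Subset n} → x ∈ T → ∣ T ∣ ≤ 0 → ∀ {A : Set} → A
memberNonEmpty x∈T size = ⊥-elim (n≮0 (≤-trans (x∈p⇒∣p-x∣<∣p∣ x∈T) size))

module Shortcut {n : ℕ} (G : SimpleGraph n) (S : Subset n) (cover : IsVertexCover G S) where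

  AllowedBy : Subset n → Fin n → Set
  AllowedBy T z = z ∈ S → z ∈ T

  mutual
    -- A walk whose cover vertices lie in T, with |T| ≤ b, can be shortened
    -- to length ≤ 2b+1: its first edge meets S, and from there we shortcut.
    shortcut : (b : ℕ) (T : Subset n) → ∣ T ∣ ≤ b → ∀ {len u v} →
               Walk (Adj G) (AllowedBy T) len u v → DistLe (Adj G) (suc (b + b)) u v
    shortcut b T size (here _) = 0 , z≤n , here tt
    shortcut b T size W@(step {u = u} {w = w} _ u~w W′) with cover u w u~w
    ... | inj₁ u∈S with shortcutFromCover b T size u∈S W
    ...   | l , l≤ , W″ = l , ≤-trans l≤ (n≤1+n _) , W″
    shortcut b T size (step {u = u} {w = w} _ u~w W′) | inj₂ w∈S
      with shortcutFromCover b T size w∈S W′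
    ... | l , l≤ , W″ = suc l , s≤s l≤ , step tt u~w W″

    -- A walk of the same kind starting at a cover vertex x can be shortened to
    -- length ≤ 2b: keep only the part after the last visit of x, which no
    -- longer uses x, so it is a walk allowed by T - x with |T - x| ≤ b - 1.
    shortcutFromCover : (b : ℕ) (T : Subset n) → ∣ T ∣ ≤ b → ∀ {len x v} → x ∈ S →
                        Walk (Adj G) (AllowedBy T) len x v → DistLe (Adj G) (b + b) x v
    shortcutFromCover zero T size x∈S W = memberNonEmpty (start W x∈S) size
    shortcutFromCover (suc b) T size {x = x} x∈S W with lastVisit x W
    ... | inj₁ W-avoids      = ⊥-elim (proj₂ (start W-avoids) refl)
    ... | inj₂ (inj₁ refl)   = 0 , z≤n , here tt
    ... | inj₂ (inj₂ (w , _ , x~w , W-after))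
      with shortcut b (T - x) (removeMember (start W x∈S) size) (weaken allowedWithout W-after)
      where
        allowedWithout : ∀ {z} → AllowedBy T z × z ≢ x → AllowedBy (T - x) z
        allowedWithout (allowed , z≢x) z∈S = x∈p∧x≢y⇒x∈p-y (allowed z∈S) z≢x
    ... | l , l≤ , W″ =
      suc l , subst (suc l ≤_) (≡-sym (+-suc (suc b) b)) (s≤s l≤) , step tt x~w W″

reachableDistance : ∀ {n k} (G : SimpleGraph n) (S : Subset n) →
                    IsVertexCover G S → ∣ S ∣ ≤ k →
                    ∀ {u v} → Reachable (Adj G) u v → DistLe (Adj G) (suc (k + k)) u v
reachableDistance G S cover size (_ , W) =
  Shortcut.shortcut G S cover _ S size (weaken (λ _ z∈S → z∈S) W)

powerWalk⇒reachable : ∀ {n} (G : SimpleGraph n) ℓ {P : Fin n → Set} {len u v} →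
                      Walk (Power G ℓ) P len u v → Reachable (Adj G) u v
powerWalk⇒reachable G ℓ (here _) = 0 , here tt
powerWalk⇒reachable G ℓ (step _ (_ , l₁ , _ , W₁) W) with powerWalk⇒reachable G ℓ W
... | l₂ , W₂ = l₁ + l₂ , W₁ ++ᵂ W₂

walk⇒powerWalk : ∀ {n} (G : SimpleGraph n) ℓ → 1 ≤ ℓ → ∀ {len u v} →
                 Walk (Adj G) (λ _ → ⊤) len u v → Walk (Power G ℓ) (λ _ → ⊤) len u v
walk⇒powerWalk G ℓ 1≤ℓ (here t) = here t
walk⇒powerWalk G ℓ 1≤ℓ (step t u~w W) =
  step t (u≢w , 1 , 1≤ℓ , step tt u~w (here tt)) (walk⇒powerWalk G ℓ 1≤ℓ W)
  where
    u≢w : _ ≢ _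
    u≢w refl = irrefl G u~w

lemma4p5 : (k ℓ : ℕ) → 1 ≤ ℓ →
    Σ ℕ λ N → 1 ≤ N ×
      ((m : ℕ) → 1 ≤ m → (n : ℕ) → (G : SimpleGraph n) →
        (Σ (Subset n) λ S → IsVertexCover G S × ∣ S ∣ ≤ k) →
        (c : Fin n → Fin m) → WeakDiameterAtMost (Power G ℓ) c N)
lemma4p5 k ℓ 1≤ℓ = suc (k + k) , s≤s z≤n , weakDiameter
  where
    weakDiameter : (m : ℕ) → 1 ≤ m → (n : ℕ) → (G : SimpleGraph n) →
                   (Σ (Subset n) λ S → IsVertexCover G S × ∣ S ∣ ≤ k) →
                   (c : Fin n → Fin m) → WeakDiameterAtMost (Power G ℓ) c (suc (k + k))
    weakDiameter m _ n G (S , cover , size) c u v (_ , monoWalk)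
      with reachableDistance G S cover size (powerWalk⇒reachable G ℓ monoWalk)
    ... | d , d≤ , W = d , d≤ , walk⇒powerWalk G ℓ 1≤ℓ W
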